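{- Let $G=(V,E)$ be a directed graph with non-negative edge weights $w$, no parallel edges, and a source $s\in V$ with no incoming edges, satisfying Assumptions A1 and A2 below. Let $t\in[1,|V|]$ be an integer and let $G'$ be obtained from $G$ by contracting $N_t(s)$ into $s$. Then: (1) for every $v\in V\setminus N_t(s)$, $\mathrm{dist}_G(s,v)=\mathrm{dist}_{G'}(s,v)$; (2) for all $u,v\in V\setminus N_t(s)$, $\mathrm{dist}_G(u,v)\le \mathrm{dist}_{G'}(u,v)$.
   Context: Paths are sequences of edges $e_1\dots e_k$ with consecutive heads/tails matching (not necessarily simple; $k=0$ allowed); the weight of a path is the sum of its edge weights, and $\mathrm{dist}_G(u,v)$ is the minimum weight of a $u\to v$ path in $G$ ($+\infty$ if none). Assumption A1: for any path $P$ in $G$ and any proper subpath $P'$ of $P$, $w(P')<w(P)$. Assumption A2: for any fixed $u\in V$, no two paths $u\to x$ and $u\to y$ with $x\ne y$ have the same weight. $N_t(u)$ denotes the set of the $t$ vertices other than $u$ that are nearest to $u$ with respect to $\mathrm{dist}_G(u,\cdot)$ (or all vertices other than $u$ reachable from $u$ if there are fewer than $t$). Contraction: for $X\subseteq V\setminus\{s\}$, let $G_0'=(V\setminus X,E')$ where $E'$ contains every edge $uv\in E$ with $u,v\notin X$ (same weight), and for every edge $xv\in E$ with $x\in X$, $v\notin X$, an edge $sv$ of weight $\mathrm{dist}_G(s,x)+w(xv)$. The graph obtained by contracting $X$ into $s$ is $G_0'$ with, among parallel edges, only one of smallest weight kept.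
   Formalization: The edge weights of G are non-negative rationals rather than non-negative reals. -}

module Defs where

open import Data.Nat using (ℕ; zero; suc) renaming (_+_ to _+ℕ_; _<_ to _<ℕ_; _⊓_ to _⊓ℕ_)
open import Data.Fin using (Fin; _≟_)
open import Data.Fin.Subset using (Subset; _∈_; _∉_; _⊆_; ∣_∣)
open import Data.Vec using (lookup; tabulate)
open import Data.Bool using (Bool; true; false; if_then_else_; _∧_; not)
open import Data.Maybe using (Maybe; just; nothing; is-just)
open import Data.List using (List; []; _∷_; map; foldr)
open import Data.List.Base using (allFin)
open import Data.Rational using (ℚ; 0ℚ; _+_; _≤_; _<_; _⊓_)
open import Data.Product using (Σ; _×_; _,_)
open import Relation.Binary.PropositionalEquality using (_≡_; _≢_)
open import Relation.Nullary using (¬_; does)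

-- A weighted directed graph on vertex set Fin n without parallel edges:
-- w u v = just q  means there is an edge u → v of weight q,
-- w u v = nothing means there is no edge u → v.
Graph : ℕ → Set
Graph n = Fin n → Fin n → Maybe ℚ

-- Extended weights: nothing plays the role of +∞.
ℚ∞ : Set
ℚ∞ = Maybe ℚ

infix 4 _≤∞_
data _≤∞_ : ℚ∞ → ℚ∞ → Set where
  fin≤fin : ∀ {p q} → p ≤ q → just p ≤∞ just q
  _≤∞∞    : ∀ (a : ℚ∞) → a ≤∞ nothing

module _ {n : ℕ} (G : Graph n) where

  data Path : Fin n → Fin n → Set where
    []  : ∀ {u} → Path u u
    step : ∀ {u v z} (q : ℚ) → G u v ≡ just q → Path v z → Path u z

  weight : ∀ {u v} → Path u v → ℚ
  weight []             = 0ℚ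
  weight (step q _ P)   = q + weight P

  len : ∀ {u v} → Path u v → ℕ
  len []           = 0
  len (step _ _ P) = suc (len P)

  _++ᵖ_ : ∀ {u v z} → Path u v → Path v z → Path u z
  []            ++ᵖ Q = Q
  (step q e P)  ++ᵖ Q = step q e (P ++ᵖ Q)

  data IsDist (u v : Fin n) : ℚ∞ → Set where
    unreachable : ¬ Path u v → IsDist u v nothing
    attained    : (P : Path u v) → (∀ (Q : Path u v) → weight P ≤ weight Q)
                → IsDist u v (just (weight P))

  A1 : Set
  A1 = ∀ {a b c d} (A : Path a b) (P′ : Path b c) (B : Path c d)
     → 0 <ℕ len A +ℕ len B → weight P′ < weight (A ++ᵖ (P′ ++ᵖ B))

  A2 : Set
  A2 = ∀ {u x y} (P : Path u x) (Q : Path u y) → x ≢ y → weight P ≢ weight Q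

  NonNegative : Set
  NonNegative = ∀ u v q → G u v ≡ just q → 0ℚ ≤ q

  NoIncoming : Fin n → Set
  NoIncoming s = ∀ u → G u s ≡ nothing

Reach : ∀ {n} → Fin n → (Fin n → ℚ∞) → Subset n
Reach s D = tabulate (λ v → not (does (v ≟ s)) ∧ is-just (D v))

IsNearest : ∀ {n} → Fin n → (Fin n → ℚ∞) → ℕ → Subset n → Set
IsNearest s D t X =
    X ⊆ Reach s D
  × ∣ X ∣ ≡ t ⊓ℕ ∣ Reach s D ∣
  × (∀ x y → x ∈ X → y ∈ Reach s D → y ∉ X → D x ≤∞ D y)

_+∞_ : ℚ∞ → ℚ∞ → ℚ∞
just p +∞ just q = just (p + q)
_      +∞ _      = nothing

min∞ : ℚ∞ → ℚ∞ → ℚ∞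
min∞ nothing b = b
min∞ a nothing = a
min∞ (just p) (just q) = just (p ⊓ q)

-- The contracted graph G' has vertex set V \ X; we represent it on the same
-- vertex set Fin n with every vertex of X isolated (no incident edges).
-- Edges u v with u,v ∉ X are kept; every edge x v with x ∈ X, v ∉ X yields an
-- edge s v of weight dist_G(s,x) + w(x v); among parallel edges the lightest is kept.
contract : ∀ {n} → Graph n → Fin n → Subset n → (Fin n → ℚ∞) → Graph n
contract {n} G s X D u v =
  if lookup X u then nothing else
  if lookup X v then nothing else
  if does (u ≟ s)
    then foldr min∞ (G s v)
           (map (λ x → if lookup X x then D x +∞ G x v else nothing) (allFin n))
    else G u v

-- Every edge s → v of the contracted graph stands for a path s ⇝ x → v of G of the same
-- weight, so contracted paths lift to G-paths that are no heavier; hence dist_G ≤ dist_G′.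
-- Conversely, a G-path s ⇝ v with v ∉ X is either disjoint from X, and then survives the
-- contraction, or it leaves X for the last time along an edge x → b; its prefix s ⇝ x weighs
-- at least dist_G(s, x), so the contracted edge s → b followed by the (surviving) rest of the
-- path is no heavier.
-- Minimal paths exist because weights are non-negative: every path can be shortened to a
-- simple one, and there are only finitely many simple paths.
module Submission where

open import Defs
open import Data.Nat using (ℕ; zero; suc; _≤_; _<_; z≤n; s≤s; _<?_)
import Data.Nat.Properties as ℕ
open import Data.Fin using (Fin; _≟_) renaming (zero to fzero; suc to fsuc; _<_ to _<ᶠ_)
open import Data.Fin.Properties using (pigeonhole)
open import Data.Fin.Subset using (Subset; _∈_; _∉_)
open import Data.Fin.Subset.Properties using (_∈?_)
open import Data.Rational using (ℚ; 0ℚ; _+_) renaming (_≤_ to _≤ℚ_)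
open import Data.Rational.Properties
  using (≤-refl; ≤-trans; ≤-total; ≤-antisym; ≤-reflexive; ⊓-sel; p⊓q≤p; p⊓q≤q
        ; +-identityˡ; +-identityʳ; +-assoc; +-mono-≤; +-monoˡ-≤; +-monoʳ-≤)
open import Data.Maybe using (just; nothing; is-just)
open import Data.Maybe.Properties using (just-injective)
open import Data.Bool using (true; false; not; _∧_; if_then_else_)
open import Data.Vec using (lookup)
open import Data.Vec.Properties using (lookup⇒[]=; []=⇒lookup; lookup∘tabulate)
open import Data.List using ([]; _∷_; allFin; map; foldr)
open import Data.List.Relation.Unary.Any using (here; there)
open import Data.List.Membership.Propositional using () renaming (_∈_ to _∈ˡ_)
open import Data.List.Membership.Propositional.Properties using (∈-allFin)
open import Data.Product using (Σ; ∃; _×_; _,_; proj₁; proj₂)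
open import Data.Sum using (_⊎_; inj₁; inj₂)
open import Data.Unit using (⊤; tt)
open import Data.Empty using (⊥; ⊥-elim)
open import Relation.Binary.PropositionalEquality using (_≡_; _≢_; refl; sym; trans; cong; subst)
open import Relation.Nullary using (¬_; Dec; yes; no; does)
open import Relation.Nullary.Decidable using (_⊎-dec_)

≤∞-refl : ∀ a → a ≤∞ a
≤∞-refl (just p) = fin≤fin ≤-refl
≤∞-refl nothing  = nothing ≤∞∞

≤∞-trans : ∀ {a b c} → a ≤∞ b → b ≤∞ c → a ≤∞ c
≤∞-trans (fin≤fin p≤q) (fin≤fin q≤r) = fin≤fin (≤-trans p≤q q≤r)
≤∞-trans {a} _         (_ ≤∞∞)       = a ≤∞∞

≤∞-just : ∀ {a p} → a ≤∞ just p → Σ ℚ λ r → a ≡ just r × r ≤ℚ p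
≤∞-just (fin≤fin r≤p) = _ , refl , r≤p

+∞-monoˡ-≤∞ : ∀ {a b} c → a ≤∞ b → a +∞ c ≤∞ b +∞ c
+∞-monoˡ-≤∞ (just r) (fin≤fin p≤q) = fin≤fin (+-monoˡ-≤ r p≤q)
+∞-monoˡ-≤∞ nothing  (fin≤fin _)   = nothing ≤∞∞
+∞-monoˡ-≤∞ {a} c    (_ ≤∞∞)       = (a +∞ c) ≤∞∞

min∞-≤∞ˡ : ∀ a b → min∞ a b ≤∞ a
min∞-≤∞ˡ nothing  b        = b ≤∞∞
min∞-≤∞ˡ (just p) nothing  = ≤∞-refl (just p)
min∞-≤∞ˡ (just p) (just q) = fin≤fin (p⊓q≤p p q)

min∞-≤∞ʳ : ∀ a b → min∞ a b ≤∞ b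
min∞-≤∞ʳ nothing  b        = ≤∞-refl b
min∞-≤∞ʳ (just p) nothing  = just p ≤∞∞
min∞-≤∞ʳ (just p) (just q) = fin≤fin (p⊓q≤q p q)

min∞-sel : ∀ a b → min∞ a b ≡ a ⊎ min∞ a b ≡ b
min∞-sel nothing  b        = inj₂ refl
min∞-sel (just p) nothing  = inj₁ refl
min∞-sel (just p) (just q) with ⊓-sel p q
... | inj₁ p⊓q≡p = inj₁ (cong just p⊓q≡p)
... | inj₂ p⊓q≡q = inj₂ (cong just p⊓q≡q)

module _ {A : Set} (f : A → ℚ∞) (b : ℚ∞) where

  foldr-min∞-≤∞-init : ∀ xs → foldr min∞ b (map f xs) ≤∞ b
  foldr-min∞-≤∞-init []       = ≤∞-refl b
  foldr-min∞-≤∞-init (x ∷ xs) = ≤∞-trans (min∞-≤∞ʳ (f x) _) (foldr-min∞-≤∞-init xs)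

  foldr-min∞-≤∞-∈ : ∀ {x xs} → x ∈ˡ xs → foldr min∞ b (map f xs) ≤∞ f x
  foldr-min∞-≤∞-∈ (here refl) = min∞-≤∞ˡ (f _) _
  foldr-min∞-≤∞-∈ {xs = y ∷ _} (there x∈xs) = ≤∞-trans (min∞-≤∞ʳ (f y) _) (foldr-min∞-≤∞-∈ x∈xs)

  foldr-min∞-sel : ∀ xs → foldr min∞ b (map f xs) ≡ b ⊎ ∃ λ x → foldr min∞ b (map f xs) ≡ f x
  foldr-min∞-sel []       = inj₁ refl
  foldr-min∞-sel (x ∷ xs) with min∞-sel (f x) (foldr min∞ b (map f xs))
  ... | inj₁ ≡fx   = inj₂ (x , ≡fx)
  ... | inj₂ ≡rest with foldr-min∞-sel xs
  ...   | inj₁ ≡b        = inj₁ (trans ≡rest ≡b)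
  ...   | inj₂ (y , ≡fy) = inj₂ (y , trans ≡rest ≡fy)

0≤q⇒p≤q+p : ∀ {p q} → 0ℚ ≤ℚ q → p ≤ℚ q + p
0≤q⇒p≤q+p {p} 0≤q = ≤-trans (≤-reflexive (sym (+-identityˡ p))) (+-monoˡ-≤ p 0≤q)

data ArgMin {A : Set} (f : A → ℚ) (P : A → Set) : Set where
  none : (∀ a → ¬ P a) → ArgMin f P
  some : ∀ a → P a → (∀ b → P b → f a ≤ℚ f b) → ArgMin f P

module _ {A : Set} {f : A → ℚ} where

  argmin-map : ∀ {P Q : A → Set} → (∀ {a} → P a → Q a) → (∀ {a} → Q a → P a)
             → ArgMin f P → ArgMin f Q
  argmin-map P⇒Q Q⇒P (none ¬P)       = none λ a Qa → ¬P a (Q⇒P Qa)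
  argmin-map P⇒Q Q⇒P (some a Pa min) = some a (P⇒Q Pa) λ b Qb → min b (Q⇒P Qb)

  argmin-⊎ : ∀ {P Q : A → Set} → ArgMin f P → ArgMin f Q → ArgMin f (λ a → P a ⊎ Q a)
  argmin-⊎ (none ¬P) (none ¬Q) = none λ { a (inj₁ Pa) → ¬P a Pa ; a (inj₂ Qa) → ¬Q a Qa }
  argmin-⊎ (none ¬P) (some a Qa min) =
    some a (inj₂ Qa) λ { b (inj₁ Pb) → ⊥-elim (¬P b Pb) ; b (inj₂ Qb) → min b Qb }
  argmin-⊎ (some a Pa min) (none ¬Q) =
    some a (inj₁ Pa) λ { b (inj₁ Pb) → min b Pb ; b (inj₂ Qb) → ⊥-elim (¬Q b Qb) }
  argmin-⊎ (some a Pa minP) (some a′ Qa′ minQ) with ≤-total (f a) (f a′)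
  ... | inj₁ a≤a′ = some a (inj₁ Pa)
                      λ { b (inj₁ Pb) → minP b Pb ; b (inj₂ Qb) → ≤-trans a≤a′ (minQ b Qb) }
  ... | inj₂ a′≤a = some a′ (inj₂ Qa′)
                      λ { b (inj₁ Pb) → ≤-trans a′≤a (minP b Pb) ; b (inj₂ Qb) → minQ b Qb }

  argmin-∃ : ∀ {m} {P : Fin m → A → Set} → (∀ i → ArgMin f (P i))
           → ArgMin f (λ a → ∃ λ i → P i a)
  argmin-∃ {zero}  _   = none λ { _ (() , _) }
  argmin-∃ {suc m} min =
    argmin-map (λ { (inj₁ p) → fzero , p ; (inj₂ (i , p)) → fsuc i , p })
               (λ { (fzero , p) → inj₁ p ; (fsuc i , p) → inj₂ (i , p) })
               (argmin-⊎ (min fzero) (argmin-∃ (λ i → min (fsuc i))))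

module Paths {n : ℕ} (G : Graph n) where

  infixr 5 _++_
  _++_ : ∀ {a b c} → Path G a b → Path G b c → Path G a c
  _++_ = _++ᵖ_ G

  w : ∀ {a b} → Path G a b → ℚ
  w = weight G

  edge : ∀ {a b q} → G a b ≡ just q → Path G a b
  edge e = step _ e []

  weight-edge : ∀ {a b q} (e : G a b ≡ just q) → w (edge e) ≡ q
  weight-edge {q = q} _ = +-identityʳ q

  weight-++ : ∀ {a b c} (P : Path G a b) (Q : Path G b c) → w (P ++ Q) ≡ w P + w Q
  weight-++ []           Q = sym (+-identityˡ (w Q))
  weight-++ (step q _ P) Q = trans (cong (q +_) (weight-++ P Q)) (sym (+-assoc q (w P) (w Q)))

  dist≤∞weight : ∀ {a b δ} → IsDist G a b δ → (P : Path G a b) → δ ≤∞ just (w P)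
  dist≤∞weight (unreachable ¬P)  P = ⊥-elim (¬P P)
  dist≤∞weight (attained _ min) P = fin≤fin (min P)

  Avoids : Subset n → ∀ {a b} → Path G a b → Set
  Avoids X {a} []           = a ∉ X
  Avoids X {a} (step _ _ R) = a ∉ X × Avoids X R

  avoids-source : ∀ {X a b} (P : Path G a b) → Avoids X P → a ∉ X
  avoids-source []           a∉X       = a∉X
  avoids-source (step _ _ _) (a∉X , _) = a∉X

  data LastExit (X : Subset n) {a v : Fin n} (P : Path G a v) : Set where
    avoiding : Avoids X P → LastExit X P
    exits    : ∀ {x b q} (Q : Path G a x) (e : G x b ≡ just q) (R : Path G b v)
             → x ∈ X → Avoids X R → w P ≡ w Q + (q + w R) → LastExit X P

  lastExit : ∀ {X a v} → v ∉ X → (P : Path G a v) → LastExit X P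
  lastExit v∉X [] = avoiding v∉X
  lastExit {X} {a} v∉X (step q e R) with lastExit v∉X R
  ... | exits Q e′ R′ x∈X avoids eq =
    exits (step q e Q) e′ R′ x∈X avoids
          (trans (cong (q +_) eq) (sym (+-assoc q (w Q) _)))
  ... | avoiding avoids with a ∈? X
  ...   | yes a∈X = exits [] e R a∈X avoids (sym (+-identityˡ _))
  ...   | no  a∉X = avoiding (a∉X , avoids)

  IsNil : ∀ {a b} → Path G a b → Set
  IsNil []           = ⊤
  IsNil (step _ _ _) = ⊥

  FirstHop : ∀ {a b} → Fin n → ℕ → Path G a b → Set
  FirstHop x k []                  = ⊥
  FirstHop x k (step {v = y} _ _ R) = y ≡ x × len G R ≤ k

  argmin-nil : ∀ a b → ArgMin w (IsNil {a} {b})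
  argmin-nil a b with a ≟ b
  ... | yes refl = some [] tt λ { [] _ → ≤-refl ; (step _ _ _) () }
  ... | no  a≢b  = none λ { [] _ → a≢b refl ; (step _ _ _) () }

  argmin-firstHop : ∀ {a b} x k → ArgMin w (λ (R : Path G x b) → len G R ≤ k)
                  → ArgMin w (FirstHop {a} {b} x k)
  argmin-firstHop {a} x k minR with G a x in e
  ... | nothing = none λ { (step _ e′ _) (refl , _) → nothing≢just (trans (sym e) e′) }
    where
    nothing≢just : ∀ {q : ℚ} → nothing ≢ just q
    nothing≢just ()
  ... | just q with minR
  ...   | none ¬R = none λ { (step _ _ R) (refl , |R|≤k) → ¬R R |R|≤k }
  ...   | some R |R|≤k min =
    some (step q e R) (refl , |R|≤k)
      λ { (step q′ e′ R′) (refl , |R′|≤k) →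
            subst (λ r → q + w R ≤ℚ r + w R′) (just-injective (trans (sym e) e′))
                  (+-monoʳ-≤ q (min R′ |R′|≤k)) }

  argmin-len≤ : ∀ k a b → ArgMin w (λ (P : Path G a b) → len G P ≤ k)
  argmin-len≤ zero a b =
    argmin-map (λ { {[]} _ → z≤n ; {step _ _ _} () })
               (λ { {[]} _ → tt ; {step _ _ _} () })
               (argmin-nil a b)
  argmin-len≤ (suc k) a b =
    argmin-map (λ { {[]} _ → z≤n
                  ; {step _ _ _} (inj₁ ())
                  ; {step _ _ _} (inj₂ (_ , refl , |R|≤k)) → s≤s |R|≤k })
               (λ { {[]} _ → inj₁ tt ; {step _ _ _} (s≤s |R|≤k) → inj₂ (_ , refl , |R|≤k) })
               (argmin-⊎ (argmin-nil a b)
                         (argmin-∃ λ x → argmin-firstHop x k (argmin-len≤ k x b)))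

  _∈ᵥ_ : ∀ {a b} → Fin n → Path G a b → Set
  _∈ᵥ_ {a} x []           = x ≡ a
  _∈ᵥ_ {a} x (step _ _ R) = x ≡ a ⊎ x ∈ᵥ R

  _∈ᵥ?_ : ∀ {a b} x (P : Path G a b) → Dec (x ∈ᵥ P)
  _∈ᵥ?_ {a} x []           = x ≟ a
  _∈ᵥ?_ {a} x (step _ _ R) = x ≟ a ⊎-dec x ∈ᵥ? R

  Simple : ∀ {a b} → Path G a b → Set
  Simple []               = ⊤
  Simple {a} (step _ _ R) = ¬ a ∈ᵥ R × Simple R

  vertexAt : ∀ {a b} (P : Path G a b) → Fin (suc (len G P)) → Fin n
  vertexAt {a} []           _        = a
  vertexAt {a} (step _ _ R) fzero    = a
  vertexAt     (step _ _ R) (fsuc i) = vertexAt R i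

  vertexAt-∈ᵥ : ∀ {a b} (P : Path G a b) i → vertexAt P i ∈ᵥ P
  vertexAt-∈ᵥ []           fzero    = refl
  vertexAt-∈ᵥ (step _ _ R) fzero    = inj₁ refl
  vertexAt-∈ᵥ (step _ _ R) (fsuc i) = inj₂ (vertexAt-∈ᵥ R i)

  simple⇒vertexAt-injective : ∀ {a b} (P : Path G a b) → Simple P
                            → ∀ {i j} → i <ᶠ j → vertexAt P i ≢ vertexAt P j
  simple⇒vertexAt-injective (step _ _ R) (a∉R , _) {fzero} {fsuc j} _ a≡vⱼ =
    a∉R (subst (_∈ᵥ R) (sym a≡vⱼ) (vertexAt-∈ᵥ R j))
  simple⇒vertexAt-injective (step _ _ R) (_ , simple) {fsuc i} {fsuc j} (s≤s i<j) =
    simple⇒vertexAt-injective R simple i<j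

  simple⇒len< : ∀ {a b} (P : Path G a b) → Simple P → len G P < n
  simple⇒len< P simple with len G P <? n
  ... | yes |P|<n = |P|<n
  ... | no  |P|≮n with pigeonhole (s≤s (ℕ.≮⇒≥ |P|≮n)) (vertexAt P)
  ...   | i , j , i<j , vᵢ≡vⱼ = ⊥-elim (simple⇒vertexAt-injective P simple i<j vᵢ≡vⱼ)

  module _ (nonneg : NonNegative G) where

    weight-nonneg : ∀ {a b} (P : Path G a b) → 0ℚ ≤ℚ w P
    weight-nonneg []           = ≤-refl
    weight-nonneg (step q e R) = ≤-trans (weight-nonneg R) (0≤q⇒p≤q+p (nonneg _ _ q e))

    suffixFrom : ∀ {a b x} (P : Path G a b) → x ∈ᵥ P
               → Σ (Path G x b) λ S → w S ≤ℚ w P × (Simple P → Simple S)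
    suffixFrom []           refl        = [] , ≤-refl , λ simple → simple
    suffixFrom (step q e R) (inj₁ refl) = step q e R , ≤-refl , λ simple → simple
    suffixFrom (step q e R) (inj₂ x∈R) with suffixFrom R x∈R
    ... | S , S≤R , simpleS =
      S , ≤-trans S≤R (0≤q⇒p≤q+p (nonneg _ _ q e)) , λ simple → simpleS (proj₂ simple)

    -- Loops are cut out from the front, keeping the last visit of each vertex.
    simplify : ∀ {a b} (P : Path G a b) → Σ (Path G a b) λ P′ → w P′ ≤ℚ w P × Simple P′
    simplify [] = [] , ≤-refl , tt
    simplify {a} (step q e R) with simplify R
    ... | R′ , R′≤R , simpleR′ with a ∈ᵥ? R′
    ...   | yes a∈R′ =
      let S , S≤R′ , simpleS = suffixFrom R′ a∈R′
      in S , ≤-trans S≤R′ (≤-trans R′≤R (0≤q⇒p≤q+p (nonneg _ _ q e))) , simpleS simpleR′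
    ...   | no  a∉R′ = step q e R′ , +-monoʳ-≤ q R′≤R , a∉R′ , simpleR′

    dist-exists : ∀ a b → Σ ℚ∞ (IsDist G a b)
    dist-exists a b with argmin-len≤ n a b
    ... | none ¬P = nothing , unreachable λ P →
      let P′ , _ , simple = simplify P in ¬P P′ (ℕ.<⇒≤ (simple⇒len< P′ simple))
    ... | some P _ min = just (w P) , attained P λ Q →
      let Q′ , Q′≤Q , simple = simplify Q in ≤-trans (min Q′ (ℕ.<⇒≤ (simple⇒len< Q′ simple))) Q′≤Q

∉⇒lookup≡false : ∀ {n} {X : Subset n} {x} → x ∉ X → lookup X x ≡ false
∉⇒lookup≡false {X = X} {x} x∉X with lookup X x in eq
... | true  = ⊥-elim (x∉X (lookup⇒[]= x X eq))
... | false = refl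

source∉Reach : ∀ {n} (s : Fin n) (D : Fin n → ℚ∞) → s ∉ Reach s D
source∉Reach s D s∈Reach = s-excluded (trans (sym (lookup∘tabulate _ s)) ([]=⇒lookup s∈Reach))
  where
  s-excluded : not (does (s ≟ s)) ∧ is-just (D s) ≢ true
  s-excluded eq with s ≟ s | eq
  ... | yes _   | ()
  ... | no  s≢s | _ = s≢s refl

module Contraction {n : ℕ} (G : Graph n) (s : Fin n) (nonneg : NonNegative G)
                   (D : Fin n → ℚ∞) (isDist : ∀ v → IsDist G s v (D v))
                   (X : Subset n) (s∉X : s ∉ X) where

  open Paths G

  G′ : Graph n
  G′ = contract G s X D

  open Paths G′ using () renaming (w to w′; dist-exists to dist′-exists)

  shortcut : Fin n → Fin n → ℚ∞
  shortcut v x = if lookup X x then D x +∞ G x v else nothing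

  contract-≤∞-edge : ∀ {u v} → u ∉ X → v ∉ X → G′ u v ≤∞ G u v
  contract-≤∞-edge {u} {v} u∉X v∉X
    rewrite ∉⇒lookup≡false u∉X | ∉⇒lookup≡false v∉X with u ≟ s
  ... | yes refl = foldr-min∞-≤∞-init (shortcut v) (G s v) (allFin n)
  ... | no  _    = ≤∞-refl (G u v)

  contract-≤∞-shortcut : ∀ {x v} → x ∈ X → v ∉ X → G′ s v ≤∞ D x +∞ G x v
  contract-≤∞-shortcut {x} {v} x∈X v∉X
    rewrite ∉⇒lookup≡false s∉X | ∉⇒lookup≡false v∉X with s ≟ s
  ... | yes _   = subst (λ b → _ ≤∞ (if b then D x +∞ G x v else nothing)) ([]=⇒lookup x∈X)
                        (foldr-min∞-≤∞-∈ (shortcut v) (G s v) (∈-allFin x))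
  ... | no  s≢s = ⊥-elim (s≢s refl)

  shortcut⇒path : ∀ x {v r} → shortcut v x ≡ just r → Σ (Path G s v) λ P → w P ≤ℚ r
  shortcut⇒path x {v} {r} = go (lookup X x) (isDist x) refl
    where
    go : ∀ b {d} → IsDist G s x d → ∀ {g} → G x v ≡ g
       → (if b then d +∞ g else nothing) ≡ just r → Σ (Path G s v) λ P → w P ≤ℚ r
    go true  (attained P _) {just q} e refl =
      P ++ edge e , ≤-reflexive (trans (weight-++ P (edge e)) (cong (w P +_) (weight-edge e)))
    go true  (attained _ _) {nothing} _ ()
    go true  (unreachable _) _ ()
    go false _ _ ()

  contract-edge⇒path : ∀ {u v r} → G′ u v ≡ just r → Σ (Path G u v) λ P → w P ≤ℚ r
  contract-edge⇒path {u} {v} eq with lookup X u | lookup X v | u ≟ s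
  contract-edge⇒path () | true  | _     | _
  contract-edge⇒path () | false | true  | _
  ... | false | false | no _ = edge eq , ≤-reflexive (weight-edge eq)
  ... | false | false | yes refl with foldr-min∞-sel (shortcut v) (G s v) (allFin n)
  ...   | inj₁ ≡Gsv      = let e = trans (sym ≡Gsv) eq in edge e , ≤-reflexive (weight-edge e)
  ...   | inj₂ (x , ≡sc) = shortcut⇒path x (trans (sym ≡sc) eq)

  contract-path⇒path : ∀ {a b} (P′ : Path G′ a b) → Σ (Path G a b) λ P → w P ≤ℚ w′ P′
  contract-path⇒path []           = [] , ≤-refl
  contract-path⇒path (step r e R′) =
    let E , E≤r = contract-edge⇒path e
        R , R≤R′ = contract-path⇒path R′
    in E ++ R , ≤-trans (≤-reflexive (weight-++ E R)) (+-mono-≤ E≤r R≤R′)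

  contract-nonneg : NonNegative G′
  contract-nonneg u v r e = let P , P≤r = contract-edge⇒path e in ≤-trans (weight-nonneg nonneg P) P≤r

  avoiding⇒contract-path : ∀ {a b} (P : Path G a b) → Avoids X P
                         → Σ (Path G′ a b) λ P′ → w′ P′ ≤ℚ w P
  avoiding⇒contract-path []           _               = [] , ≤-refl
  avoiding⇒contract-path {a} (step {v = b} q e R) (a∉X , avoidsR)
    with ≤∞-just (subst (G′ a b ≤∞_) e (contract-≤∞-edge a∉X (avoids-source R avoidsR)))
  ... | r , e′ , r≤q =
    let R′ , R′≤R = avoiding⇒contract-path R avoidsR
    in step r e′ R′ , +-mono-≤ r≤q R′≤R

  shortcut-bound : ∀ {x b q} → x ∈ X → b ∉ X → G x b ≡ just q → (Q : Path G s x)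
                 → G′ s b ≤∞ just (w Q + q)
  shortcut-bound {x} {q = q} x∈X b∉X e Q =
    ≤∞-trans (contract-≤∞-shortcut x∈X b∉X)
             (subst (λ g → D x +∞ g ≤∞ just (w Q + q)) (sym e)
                    (+∞-monoˡ-≤∞ (just q) (dist≤∞weight (isDist x) Q)))

  path⇒contract-path : ∀ {v} → v ∉ X → (P : Path G s v) → Σ (Path G′ s v) λ P′ → w′ P′ ≤ℚ w P
  path⇒contract-path v∉X P with lastExit v∉X P
  ... | avoiding avoids = avoiding⇒contract-path P avoids
  ... | exits {q = q} Q e R x∈X avoids P≡Q+q+R
    with ≤∞-just (shortcut-bound x∈X (avoids-source R avoids) e Q)
  ...   | r , e′ , r≤Q+q =
    let R′ , R′≤R = avoiding⇒contract-path R avoids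
    in step r e′ R′ , ≤-trans (+-mono-≤ r≤Q+q R′≤R)
                              (≤-reflexive (trans (+-assoc (w Q) q (w R)) (sym P≡Q+q+R)))

  dist-from-source-preserved : ∀ v → v ∉ X → Σ ℚ∞ λ δ → IsDist G s v δ × IsDist G′ s v δ
  dist-from-source-preserved v v∉X with D v | isDist v
  ... | _ | unreachable ¬P =
    nothing , unreachable ¬P , unreachable λ P′ → ¬P (proj₁ (contract-path⇒path P′))
  ... | _ | attained P min =
    just (w P) , attained P min , subst (λ d → IsDist G′ s v (just d)) P′≡P (attained P′ min′)
    where
    P′   = proj₁ (path⇒contract-path v∉X P)
    P′≤P = proj₂ (path⇒contract-path v∉X P)
    P≤ : ∀ Q′ → w P ≤ℚ w′ Q′
    P≤ Q′ = let Q , Q≤Q′ = contract-path⇒path Q′ in ≤-trans (min Q) Q≤Q′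
    min′ : ∀ Q′ → w′ P′ ≤ℚ w′ Q′
    min′ Q′ = ≤-trans P′≤P (P≤ Q′)
    P′≡P : w′ P′ ≡ w P
    P′≡P = ≤-antisym P′≤P (P≤ P′)

  dist-≤∞-contract : ∀ {u v δ δ′} → IsDist G u v δ → IsDist G′ u v δ′ → δ ≤∞ δ′
  dist-≤∞-contract {δ = δ} _ (unreachable _) = δ ≤∞∞
  dist-≤∞-contract isDistG (attained P′ _) =
    let P , P≤P′ = contract-path⇒path P′ in ≤∞-trans (dist≤∞weight isDistG P) (fin≤fin P≤P′)

  dist≤dist-contract : ∀ u v → Σ ℚ∞ λ δ → Σ ℚ∞ λ δ′ → IsDist G u v δ × IsDist G′ u v δ′ × δ ≤∞ δ′
  dist≤dist-contract u v with dist-exists nonneg u v | dist′-exists contract-nonneg u v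
  ... | δ , isDistG | δ′ , isDistG′ = δ , δ′ , isDistG , isDistG′ , dist-≤∞-contract isDistG isDistG′

lemma3p3 : ∀ {n : ℕ} (G : Graph n) (s : Fin n)
    → NonNegative G → NoIncoming G s → A1 G → A2 G
    → (t : ℕ) → 1 ≤ t → t ≤ n
    → (D : Fin n → ℚ∞) → (∀ v → IsDist G s v (D v))
    → (X : Subset n) → IsNearest s D t X
    → (∀ v → v ∉ X → Σ ℚ∞ (λ δ → IsDist G s v δ × IsDist (contract G s X D) s v δ))
      × (∀ u v → u ∉ X → v ∉ X
           → Σ ℚ∞ (λ δ → Σ ℚ∞ (λ δ′ → IsDist G u v δ × IsDist (contract G s X D) u v δ′ × δ ≤∞ δ′)))
lemma3p3 G s nonneg _ _ _ _ _ _ D isDist X (X⊆Reach , _ , _) =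
  dist-from-source-preserved , λ u v _ _ → dist≤dist-contract u v
  where
  open Contraction G s nonneg D isDist X (λ s∈X → source∉Reach s D (X⊆Reach s∈X))
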